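{- Let $p$ be an odd prime, $r\ge2$, and let $\theta\in\overline{\mathbb{F}}_2$ satisfy $\theta^{p^r}=1$ but $\theta^p\ne1$. Then for every $0\le l<p$, $D_l(\theta)=0$.
   Context: Let $\varphi$ be Euler's totient function. For $r\ge1$, $Q_r(u)$ is the unique integer with $0\le Q_r(u)<p^r$ and $Q_r(u)\equiv \frac{u^{\varphi(p^r)}-1}{p^r}\pmod{p^r}$ if $\gcd(u,p)=1$, and $Q_r(u)=0$ if $p\mid u$. Define $H_0=Q_1$ and for $r\ge2$ let $H_{r-1}(u)\in\{0,\dots,p-1\}$ with $H_{r-1}(u)\equiv (Q_r(u)-Q_{r-1}(u))/p^{r-1}\pmod p$. For $0\le l<p$, $D_l=\{u:0\le u<p^{r+1},\ \gcd(u,p)=1,\ H_{r-1}(u)=l\}$ and $D_l(X)=\sum_{u\in D_l}X^u\in\mathbb{F}_2[X]$. $\overline{\mathbb{F}}_2$ is an algebraic closure of $\mathbb{F}_2$. -}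

module Defs where

open import Level using (Level; suc; _⊔_)
open import Data.Nat as ℕ using (ℕ; zero; NonZero; _≡ᵇ_; _∸_)
open import Data.Nat.Properties using (m^n≢0)
open import Data.Nat.GCD using (gcd)
open import Data.Nat.DivMod as ND using ()
open import Data.Integer as ℤ using (ℤ; +_; _-_)
open import Data.Integer.DivMod using (_/ℕ_; _%ℕ_)
open import Data.Bool using (Bool; if_then_else_; _∧_)
open import Data.List using (List; upTo; filter; length; foldr)
open import Relation.Binary.PropositionalEquality using (_≡_)
open import Relation.Nullary using (¬_)
open import Data.Product using (∃)
open import Algebra.Bundles using (CommutativeRing)

coprimeᵇ : ℕ → ℕ → Bool
coprimeᵇ u n = gcd u n ≡ᵇ 1

φ : ℕ → ℕ
φ n = length (foldr (λ u acc → if coprimeᵇ u n then u Data.List.∷ acc else acc) Data.List.[] (upTo n))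

module _ (p : ℕ) .{{_ : NonZero p}} where

  _÷pow_ : ℕ → ℕ → ℕ
  n ÷pow k = ND._/_ n (p ℕ.^ k) {{m^n≢0 p k}}

  _%pow_ : ℕ → ℕ → ℕ
  n %pow k = ND._%_ n (p ℕ.^ k) {{m^n≢0 p k}}

  Q : ℕ → ℕ → ℕ
  Q r u = if coprimeᵇ u p
          then ((u ℕ.^ φ (p ℕ.^ r) ∸ 1) ÷pow r) %pow r
          else 0

  -- H_{r-1}(u) ∈ {0,…,p-1}, ≡ (Q_r(u) - Q_{r-1}(u)) / p^{r-1} (mod p)
  H : ℕ → ℕ → ℕ
  H r u = (((+ Q r u) - (+ Q (r ∸ 1) u)) /ℕ (p ℕ.^ (r ∸ 1))) {{m^n≢0 p (r ∸ 1)}} %ℕ p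

  inDᵇ : ℕ → ℕ → ℕ → Bool
  inDᵇ r l u = coprimeᵇ u p ∧ (H r u ≡ᵇ l)

record IsFieldChar2 {c ℓ : Level} (R : CommutativeRing c ℓ) : Set (c ⊔ ℓ) where
  open CommutativeRing R
  field
    nontrivial : ¬ (1# ≈ 0#)
    inverse    : ∀ x → ¬ (x ≈ 0#) → ∃ λ y → (x * y) ≈ 1#
    char2      : (1# + 1#) ≈ 0#

module _ {c ℓ : Level} (R : CommutativeRing c ℓ) where
  open CommutativeRing R

  pow : Carrier → ℕ → Carrier
  pow x zero = 1#
  pow x (ℕ.suc n) = x * pow x n

  -- evaluation at θ of the F_2-polynomial Σ_{u < N, P u} X^u (image in R)
  evalSum : (ℕ → Bool) → ℕ → Carrier → Carrier
  evalSum P N θ = foldr (λ u acc → if P u then pow θ u + acc else acc) 0# (upTo N)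

  Deval : (p : ℕ) .{{_ : NonZero p}} → ℕ → ℕ → Carrier → Carrier
  Deval p r l θ = evalSum (inDᵇ p r l) (p ℕ.^ (ℕ.suc r)) θ

-- Split u < p^(r+1) as u = j·p^r + c with j < p and c < p^r; then θ^u = θ^c. If p ∣ c, no such u
-- lies in D_l. If p ∤ c, the binomial theorem applied to (c + j·p^r)^φ(p^r) shows that
-- H_{r-1}(j·p^r + c) ≡ H_{r-1}(c) + α·j (mod p) with α = (p-1)·c^(φ(p^r)-1) prime to p, so exactly
-- one j < p puts u into D_l. Hence D_l(θ) = Σ_{c < p^r, p ∤ c} θ^c, the difference of the geometric
-- sums Σ_{c < p^r} θ^c and Σ_{j < p^(r-1)} (θ^p)^j, which both vanish as θ ≠ 1 and θ^p ≠ 1.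
module Submission where

open import Defs
open import Level using (Level)
open import Algebra.Bundles using (CommutativeMonoid; CommutativeRing)
open import Data.Bool using (Bool; true; false; not; if_then_else_; _∧_)
open import Data.Nat as ℕ using (ℕ; zero; suc; pred; NonZero; _<_; _≤_; _^_; z<s; s<s; s≤s; z≤n)
import Data.Nat.Properties as ℕ
open import Data.Nat.DivMod using (_/_; _%_)
import Data.Nat.DivMod as ℕ
open import Data.Nat.Divisibility
  using (_∣_; _∤_; _∣?_; _∣0; divides; >⇒∤; ∣m+n∣m⇒∣n; ∣m∣n⇒∣m+n; n∣m*n; m∣m*n; ∣-trans; ∣1⇒≡1)
open import Data.Nat.Primality using (Prime; prime⇒irreducible; prime⇒nonTrivial; prime⇒nonZero; euclidsLemma)
open import Data.Nat.Coprimality using (Coprime; coprime?; coprime-divisor)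
import Data.Nat.Tactic.RingSolver as ℕ-Solver
open import Data.Fin using (Fin; toℕ; fromℕ<; punchOut)
open import Data.Fin.Properties using (any?; _≟_; punchOut-injective; injective⇒≤; toℕ-injective; toℕ-fromℕ<; toℕ<n)
open import Data.List using ([]; _∷_; length; foldr; applyUpTo)
open import Data.Product using (∃; _×_; _,_; proj₁; proj₂)
open import Data.Sum using (inj₁; inj₂)
open import Function using (_∘_)
open import Function.Bundles using (_⇔_; mk⇔)
open import Function.Definitions using (Injective)
open import Relation.Nullary using (¬_; ¬?; Dec; yes; no; does; contradiction)
open import Relation.Nullary.Decidable using (dec-true; dec-false; does-⇔)
open import Relation.Binary.PropositionalEquality as ≡ using (_≡_; _≢_)

∣?-+-multiple : ∀ {d m} n → d ∣ m → does (d ∣? (m ℕ.+ n)) ≡ does (d ∣? n)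
∣?-+-multiple {d} {m} n d∣m =
  does-⇔ (mk⇔ (λ d∣m+n → ∣m+n∣m⇒∣n d∣m+n d∣m) (∣m∣n⇒∣m+n d∣m)) (d ∣? (m ℕ.+ n)) (d ∣? n)

[m+n]%d≡m%d⇒d∣n : ∀ m n d .{{_ : NonZero d}} → (m ℕ.+ n) % d ≡ m % d → d ∣ n
[m+n]%d≡m%d⇒d∣n m n d eq = divides (q′ ℕ.∸ q) (begin
  n                                             ≡⟨ ℕ.m+n∸m≡n m n ⟨
  m ℕ.+ n ℕ.∸ m                                 ≡⟨ ≡.cong₂ ℕ._∸_ (ℕ.m≡m%n+[m/n]*n (m ℕ.+ n) d) (ℕ.m≡m%n+[m/n]*n m d) ⟩
  (m ℕ.+ n) % d ℕ.+ q′ ℕ.* d ℕ.∸ (m % d ℕ.+ q ℕ.* d) ≡⟨ ≡.cong (λ x → x ℕ.+ q′ ℕ.* d ℕ.∸ (m % d ℕ.+ q ℕ.* d)) eq ⟩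
  m % d ℕ.+ q′ ℕ.* d ℕ.∸ (m % d ℕ.+ q ℕ.* d)    ≡⟨ ℕ.[m+n]∸[m+o]≡n∸o (m % d) (q′ ℕ.* d) (q ℕ.* d) ⟩
  q′ ℕ.* d ℕ.∸ q ℕ.* d                          ≡⟨ ℕ.*-distribʳ-∸ d q′ q ⟨
  (q′ ℕ.∸ q) ℕ.* d                              ∎)
  where
  open ≡.≡-Reasoning
  q′ = (m ℕ.+ n) / d
  q  = m / d

[m+kn]/n≡m/n+k : ∀ m k n .{{_ : NonZero n}} → (m ℕ.+ k ℕ.* n) / n ≡ m / n ℕ.+ k
[m+kn]/n≡m/n+k m k n = ≡.trans (ℕ.+-distrib-/-∣ʳ m (divides k ≡.refl)) (≡.cong (m / n ℕ.+_) (ℕ.m*n/n≡m k n))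

binomial-mod-d² : ∀ c d n → ∃ λ R → (c ℕ.+ d) ^ n ≡ c ^ n ℕ.+ n ℕ.* c ^ pred n ℕ.* d ℕ.+ d ℕ.* d ℕ.* R
binomial-mod-d² c d zero          = 0 , ≡.cong suc (≡.sym (ℕ.*-zeroʳ (d ℕ.* d)))
binomial-mod-d² c d (suc zero)    = 0 , base c d
  where
  base : ∀ c d → (c ℕ.+ d) ℕ.* 1 ≡ c ℕ.* 1 ℕ.+ 1 ℕ.* 1 ℕ.* d ℕ.+ d ℕ.* d ℕ.* 0
  base = ℕ-Solver.solve-∀
binomial-mod-d² c d (suc (suc n)) with R , eq ← binomial-mod-d² c d (suc n) =
  c ℕ.* R ℕ.+ suc n ℕ.* c ^ n ℕ.+ d ℕ.* R , ≡.trans (≡.cong ((c ℕ.+ d) ℕ.*_) eq) (step c d n (c ^ n) R)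
  where
  step : ∀ c d n X R → (c ℕ.+ d) ℕ.* (c ℕ.* X ℕ.+ suc n ℕ.* X ℕ.* d ℕ.+ d ℕ.* d ℕ.* R) ≡
         c ℕ.* (c ℕ.* X) ℕ.+ suc (suc n) ℕ.* (c ℕ.* X) ℕ.* d ℕ.+ d ℕ.* d ℕ.* (c ℕ.* R ℕ.+ suc n ℕ.* X ℕ.+ d ℕ.* R)
  step = ℕ-Solver.solve-∀

injective⇒surjective : ∀ {n} {f : Fin n → Fin n} → Injective _≡_ _≡_ f → ∀ y → ∃ λ x → f x ≡ y
injective⇒surjective {suc n} {f} f-injective y with any? (λ x → f x ≟ y)
... | yes hit = hit
... | no miss = contradiction (injective⇒≤ punchOut∘f-injective) ℕ.1+n≰n
  where
  y≢f : ∀ x → y ≢ f x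
  y≢f x y≡fx = miss (x , ≡.sym y≡fx)
  punchOut∘f-injective : Injective _≡_ _≡_ (λ x → punchOut (y≢f x))
  punchOut∘f-injective eq = f-injective (punchOut-injective (y≢f _) (y≢f _) eq)

module Sum {c ℓ} (M : CommutativeMonoid c ℓ) where
  open CommutativeMonoid M
  open import Algebra.Properties.CommutativeSemigroup commutativeSemigroup using (interchange)
  open import Relation.Binary.Reasoning.Setoid setoid

  ∑ : ℕ → (ℕ → Carrier) → Carrier
  ∑ zero    f = ε
  ∑ (suc n) f = f 0 ∙ ∑ n (f ∘ suc)

  ∑-cong : ∀ n {f g} → (∀ i → i < n → f i ≈ g i) → ∑ n f ≈ ∑ n g
  ∑-cong zero    f≈g = refl
  ∑-cong (suc n) f≈g = ∙-cong (f≈g 0 z<s) (∑-cong n (λ i i<n → f≈g (suc i) (s<s i<n)))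

  ∑-congᵖ : ∀ n {f g} → (∀ i → f i ≡ g i) → ∑ n f ≈ ∑ n g
  ∑-congᵖ n f≡g = ∑-cong n (λ i _ → reflexive (f≡g i))

  ∑-ε : ∀ n {f} → (∀ i → i < n → f i ≈ ε) → ∑ n f ≈ ε
  ∑-ε zero    f≈ε = refl
  ∑-ε (suc n) f≈ε = trans (∙-cong (f≈ε 0 z<s) (∑-ε n (λ i i<n → f≈ε (suc i) (s<s i<n)))) (identityˡ ε)

  ∑-distrib : ∀ n f g → ∑ n (λ i → f i ∙ g i) ≈ ∑ n f ∙ ∑ n g
  ∑-distrib zero    f g = sym (identityˡ ε)
  ∑-distrib (suc n) f g = trans (∙-cong refl (∑-distrib n (f ∘ suc) (g ∘ suc))) (interchange _ _ _ _)

  ∑-split : ∀ m n f → ∑ (m ℕ.+ n) f ≈ ∑ m f ∙ ∑ n (λ i → f (m ℕ.+ i))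
  ∑-split zero    n f = sym (identityˡ _)
  ∑-split (suc m) n f = trans (∙-cong refl (∑-split m n (f ∘ suc))) (sym (assoc _ _ _))

  ∑-blocks : ∀ k B f → ∑ (k ℕ.* B) f ≈ ∑ k (λ j → ∑ B (λ i → f (j ℕ.* B ℕ.+ i)))
  ∑-blocks zero    B f = refl
  ∑-blocks (suc k) B f = begin
    ∑ (B ℕ.+ k ℕ.* B) f
      ≈⟨ ∑-split B (k ℕ.* B) f ⟩
    ∑ B f ∙ ∑ (k ℕ.* B) (λ i → f (B ℕ.+ i))
      ≈⟨ ∙-cong refl (∑-blocks k B (λ i → f (B ℕ.+ i))) ⟩
    ∑ B f ∙ ∑ k (λ j → ∑ B (λ i → f (B ℕ.+ (j ℕ.* B ℕ.+ i))))
      ≈⟨ ∙-cong refl (∑-cong k (λ j _ → ∑-congᵖ B (reassoc j))) ⟩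
    ∑ (suc k) (λ j → ∑ B (λ i → f (j ℕ.* B ℕ.+ i)))           ∎
    where
    reassoc : ∀ j i → f (B ℕ.+ (j ℕ.* B ℕ.+ i)) ≡ f (B ℕ.+ j ℕ.* B ℕ.+ i)
    reassoc j i = ≡.cong f (≡.sym (ℕ.+-assoc B (j ℕ.* B) i))

  ∑-comm : ∀ m n (g : ℕ → ℕ → Carrier) → ∑ n (λ j → ∑ m (g j)) ≈ ∑ m (λ i → ∑ n (λ j → g j i))
  ∑-comm m zero    g = sym (∑-ε m (λ _ _ → refl))
  ∑-comm m (suc n) g = trans (∙-cong refl (∑-comm m n (g ∘ suc))) (sym (∑-distrib m (g 0) _))

  ∑-single : ∀ n j₀ {f x} → j₀ < n → f j₀ ≈ x → (∀ j → j < n → j ≢ j₀ → f j ≈ ε) → ∑ n f ≈ x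
  ∑-single (suc n) zero     _          f0≈x others =
    trans (∙-cong f0≈x (∑-ε n (λ j j<n → others (suc j) (s<s j<n) λ ()))) (identityʳ _)
  ∑-single (suc n) (suc j₀) {f} (s<s j₀<n) fj₀≈x others =
    trans (∙-cong (others 0 z<s λ ()) (∑-single n j₀ j₀<n fj₀≈x others′)) (identityˡ _)
    where
    others′ : ∀ j → j < n → j ≢ j₀ → f (suc j) ≈ ε
    others′ j j<n j≢j₀ = others (suc j) (s<s j<n) (j≢j₀ ∘ ℕ.suc-injective)

  ∑-partition : ∀ n (b : ℕ → Bool) f →
                ∑ n f ≈ ∑ n (λ i → if b i then f i else ε) ∙ ∑ n (λ i → if b i then ε else f i)
  ∑-partition n b f = trans (∑-cong n (λ i _ → split (b i))) (∑-distrib n _ _)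
    where
    split : ∀ {x} (c : Bool) → x ≈ (if c then x else ε) ∙ (if c then ε else x)
    split true  = sym (identityʳ _)
    split false = sym (identityˡ _)

  ∑-multiples : ∀ m p .{{_ : NonZero p}} (f : ℕ → Carrier) →
                ∑ (m ℕ.* p) (λ u → if does (p ∣? u) then f u else ε) ≈ ∑ m (λ j → f (j ℕ.* p))
  ∑-multiples m p f =
    trans (∑-blocks m p F) (∑-cong m (λ j _ → ∑-single p 0 (ℕ.>-nonZero⁻¹ p) (at-0 j) (elsewhere j)))
    where
    F : ℕ → Carrier
    F u = if does (p ∣? u) then f u else ε
    at-0 : ∀ j → F (j ℕ.* p ℕ.+ 0) ≈ f (j ℕ.* p)
    at-0 j = reflexive (≡.trans (≡.cong F (ℕ.+-identityʳ (j ℕ.* p)))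
                                (≡.cong (λ b → if b then f (j ℕ.* p) else ε) (dec-true (p ∣? (j ℕ.* p)) (n∣m*n j))))
    elsewhere : ∀ j i → i < p → i ≢ 0 → F (j ℕ.* p ℕ.+ i) ≈ ε
    elsewhere j zero    _   0≢0 = contradiction ≡.refl 0≢0
    elsewhere j (suc i) i<p _   = reflexive (≡.cong (λ b → if b then f (j ℕ.* p ℕ.+ suc i) else ε)
      (≡.trans (∣?-+-multiple {p} (suc i) (n∣m*n j)) (dec-false (p ∣? suc i) (>⇒∤ i<p))))

module IntegerDivision where
  open ≡ using (refl; sym; trans; cong)
  open import Data.Integer using (ℤ; +_; +[1+_]; -[1+_]; 0ℤ; _+_; _*_; _-_; -_)
  open import Data.Integer.Properties using (pos-+; pos-*; +-injective; i-j≡0⇒i≡j; +-identityʳ; +-assoc)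
  open import Data.Integer.DivMod using (_/ℕ_; _%ℕ_; a≡a%ℕn+[a/ℕn]*n; n%ℕd<d)
  open import Data.Integer.Tactic.RingSolver using (solve-∀)

  pos-+-* : ∀ a n d → + (a ℕ.+ n ℕ.* d) ≡ + a + + n * + d
  pos-+-* a n d = trans (pos-+ a (n ℕ.* d)) (cong (λ x → + a + x) (pos-* n d))

  d≤a-if-a≡b+[1+t]d : ∀ {a b d} t → + a ≡ + b + +[1+ t ] * + d → d ℕ.≤ a
  d≤a-if-a≡b+[1+t]d {a} {b} {d} t eq = begin
    d                   ≤⟨ ℕ.m≤m+n d (t ℕ.* d) ⟩
    suc t ℕ.* d         ≤⟨ ℕ.m≤n+m _ b ⟩
    b ℕ.+ suc t ℕ.* d   ≡⟨ +-injective (trans (pos-+-* b (suc t) d) (sym eq)) ⟩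
    a                   ∎
    where open ℕ.≤-Reasoning

  +r≡+r′+i*d⇒i≡0 : ∀ {d r r′} (i : ℤ) → r < d → r′ < d → + r ≡ + r′ + i * + d → i ≡ 0ℤ
  +r≡+r′+i*d⇒i≡0 (+ zero)  _   _    _  = refl
  +r≡+r′+i*d⇒i≡0 +[1+ t ] r<d _ eq = contradiction (d≤a-if-a≡b+[1+t]d t eq) (ℕ.<⇒≱ r<d)
  +r≡+r′+i*d⇒i≡0 {d} {r} {r′} -[1+ t ] _ r′<d eq =
    contradiction (d≤a-if-a≡b+[1+t]d t (move (+ r) (+ r′) +[1+ t ] (+ d) eq)) (ℕ.<⇒≱ r′<d)
    where
    move : ∀ a b i e → a ≡ b + (- i) * e → b ≡ a + i * e
    move a b i e eq = trans (add-and-cancel b i e) (cong (_+ i * e) (sym eq))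
      where
      add-and-cancel : ∀ b i e → b ≡ (b + (- i) * e) + i * e
      add-and-cancel = solve-∀

  divMod-unique : ∀ n d .{{_ : NonZero d}} r q → r < d → n ≡ + r + q * + d → n %ℕ d ≡ r × n /ℕ d ≡ q
  divMod-unique n d r q r<d n≡ = sym (+-injective r≡r₀) , i-j≡0⇒i≡j _ _ q₀-q≡0
    where
    r₀ = n %ℕ d
    q₀ = n /ℕ d
    rearrange : ∀ r r₀ q q₀ d → r + q * d ≡ r₀ + q₀ * d → r ≡ r₀ + (q₀ - q) * d
    rearrange r r₀ q q₀ d eq = trans (cancel r q d) (trans (cong (_- q * d) eq) (factor r₀ q₀ q d))
      where
      cancel : ∀ r q d → r ≡ (r + q * d) - q * d
      cancel = solve-∀
      factor : ∀ r₀ q₀ q d → (r₀ + q₀ * d) - q * d ≡ r₀ + (q₀ - q) * d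
      factor = solve-∀
    r≡ : + r ≡ + r₀ + (q₀ - q) * + d
    r≡ = rearrange (+ r) (+ r₀) q q₀ (+ d) (trans (sym n≡) (a≡a%ℕn+[a/ℕn]*n n d))
    q₀-q≡0 : q₀ - q ≡ 0ℤ
    q₀-q≡0 = +r≡+r′+i*d⇒i≡0 (q₀ - q) r<d (n%ℕd<d n d) r≡
    r≡r₀ : + r ≡ + r₀
    r≡r₀ = trans r≡ (trans (cong (λ i → + r₀ + i * + d) q₀-q≡0) (+-identityʳ (+ r₀)))

  [n+q*d]/ℕd≡n/ℕd+q : ∀ n q d .{{_ : NonZero d}} → (n + q * + d) /ℕ d ≡ n /ℕ d + q
  [n+q*d]/ℕd≡n/ℕd+q n q d = proj₂ (divMod-unique (n + q * + d) d (n %ℕ d) (n /ℕ d + q) (n%ℕd<d n d) eq)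
    where
    regroup : ∀ n r q₀ q d → n ≡ r + q₀ * d → n + q * d ≡ r + (q₀ + q) * d
    regroup n r q₀ q d refl = collect r q₀ q d
      where
      collect : ∀ r q₀ q d → (r + q₀ * d) + q * d ≡ r + (q₀ + q) * d
      collect = solve-∀
    eq : n + q * + d ≡ + (n %ℕ d) + (n /ℕ d + q) * + d
    eq = regroup n (+ (n %ℕ d)) (n /ℕ d) q (+ d) (a≡a%ℕn+[a/ℕn]*n n d)

  [n+m+q*d]%ℕd≡[n%ℕd+m]%d : ∀ n m q d .{{_ : NonZero d}} →
                            (n + + m + q * + d) %ℕ d ≡ (n %ℕ d ℕ.+ m) ℕ.% d
  [n+m+q*d]%ℕd≡[n%ℕd+m]%d n m q d =
    proj₁ (divMod-unique (n + + m + q * + d) d (s ℕ.% d) (+ (s ℕ./ d) + n /ℕ d + q) (ℕ.m%n<n s d) eq)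
    where
    s = n %ℕ d ℕ.+ m
    s≡ : + (n %ℕ d) + + m ≡ + (s ℕ.% d) + + (s ℕ./ d) * + d
    s≡ = trans (sym (pos-+ (n %ℕ d) m))
               (trans (cong +_ (ℕ.m≡m%n+[m/n]*n s d)) (pos-+-* (s ℕ.% d) (s ℕ./ d) d))
    regroup : ∀ n r m r′ q′ q₀ q d → n ≡ r + q₀ * d → r + m ≡ r′ + q′ * d →
              n + m + q * d ≡ r′ + (q′ + q₀ + q) * d
    regroup n r m r′ q′ q₀ q d refl eq =
      trans (reorder r m q₀ q d) (trans (cong (λ x → x + (q₀ + q) * d) eq) (collect r′ q′ q₀ q d))
      where
      reorder : ∀ r m q₀ q d → r + q₀ * d + m + q * d ≡ (r + m) + (q₀ + q) * d
      reorder = solve-∀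
      collect : ∀ r′ q′ q₀ q d → r′ + q′ * d + (q₀ + q) * d ≡ r′ + (q′ + q₀ + q) * d
      collect = solve-∀
    eq : n + + m + q * + d ≡ + (s ℕ.% d) + (+ (s ℕ./ d) + n /ℕ d + q) * + d
    eq = regroup n (+ (n %ℕ d)) (+ m) (+ (s ℕ.% d)) (+ (s ℕ./ d)) (n /ℕ d) q (+ d) (a≡a%ℕn+[a/ℕn]*n n d) s≡

  digit-shift : ∀ e d .{{_ : NonZero e}} .{{_ : NonZero d}} .{{_ : NonZero (e ℕ.* d)}} a m w →
                ((+ ((a ℕ.+ d ℕ.* m) ℕ.% (e ℕ.* d)) - + w) /ℕ d) %ℕ e ≡
                ((((+ (a ℕ.% (e ℕ.* d)) - + w) /ℕ d) %ℕ e) ℕ.+ m) ℕ.% e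
  digit-shift e d a m w = begin
    ((+ r′ - + w) /ℕ d) %ℕ e                  ≡⟨ cong (λ z → (z /ℕ d) %ℕ e) r′-w≡ ⟩
    ((x + (+ m + t * + e) * + d) /ℕ d) %ℕ e   ≡⟨ cong (_%ℕ e) ([n+q*d]/ℕd≡n/ℕd+q x (+ m + t * + e) d) ⟩
    (x /ℕ d + (+ m + t * + e)) %ℕ e           ≡⟨ cong (_%ℕ e) (+-assoc (x /ℕ d) (+ m) (t * + e)) ⟨
    (x /ℕ d + + m + t * + e) %ℕ e             ≡⟨ [n+m+q*d]%ℕd≡[n%ℕd+m]%d (x /ℕ d) m t e ⟩
    ((x /ℕ d) %ℕ e ℕ.+ m) ℕ.% e               ∎
    where
    open ≡.≡-Reasoning
    D = e ℕ.* d
    r = a ℕ.% D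
    r′ = (a ℕ.+ d ℕ.* m) ℕ.% D
    x = + r - + w
    t = + (a ℕ./ D) - + ((a ℕ.+ d ℕ.* m) ℕ./ D)
    divMod-ℤ : ∀ n → + n ≡ + (n ℕ.% D) + + (n ℕ./ D) * (+ e * + d)
    divMod-ℤ n = trans (cong +_ (ℕ.m≡m%n+[m/n]*n n D))
      (trans (pos-+-* (n ℕ.% D) (n ℕ./ D) D) (cong (λ z → + (n ℕ.% D) + + (n ℕ./ D) * z) (pos-* e d)))
    regroup : ∀ A r r′ q q′ w m e d → A ≡ r + q * (e * d) → A + d * m ≡ r′ + q′ * (e * d) →
              r′ - w ≡ (r - w) + (m + (q - q′) * e) * d
    regroup A r r′ q q′ w m e d refl eq =
      trans (cancel r′ q′ w e d) (trans (cong (λ z → z - q′ * (e * d) - w) (sym eq)) (collect r q q′ w m e d))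
      where
      cancel : ∀ r′ q′ w e d → r′ - w ≡ (r′ + q′ * (e * d)) - q′ * (e * d) - w
      cancel = solve-∀
      collect : ∀ r q q′ w m e d →
                (r + q * (e * d)) + d * m - q′ * (e * d) - w ≡ (r - w) + (m + (q - q′) * e) * d
      collect = solve-∀
    r′-w≡ : + r′ - + w ≡ x + (+ m + t * + e) * + d
    r′-w≡ = regroup (+ a) (+ r) (+ r′) (+ (a ℕ./ D)) (+ ((a ℕ.+ d ℕ.* m) ℕ./ D)) (+ w) (+ m) (+ e) (+ d)
              (divMod-ℤ a) (trans (sym (pos-+-* a d m)) (divMod-ℤ (a ℕ.+ d ℕ.* m)))

module DivisibilityByPrime {p : ℕ} (p-prime : Prime p) where
  open ≡ using (refl; sym; trans; cong)

  p≢1 : p ≢ 1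
  p≢1 = ℕ.nonTrivial⇒≢1 {{prime⇒nonTrivial p-prime}}

  ∤⇒coprime : ∀ {u} → p ∤ u → Coprime u p
  ∤⇒coprime p∤u (d∣u , d∣p) with prime⇒irreducible p-prime d∣p
  ... | inj₁ d≡1  = d≡1
  ... | inj₂ refl = contradiction d∣u p∤u

  ∤⇒coprime-^ : ∀ {u} → p ∤ u → ∀ k → Coprime u (p ^ k)
  ∤⇒coprime-^ _   zero    (_ , d∣1) = ∣1⇒≡1 d∣1
  ∤⇒coprime-^ p∤u (suc k) {d} (d∣u , d∣pᵏ⁺¹) = ∤⇒coprime-^ p∤u k (d∣u , coprime-divisor d⊥p d∣pᵏ⁺¹)
    where
    d⊥p : Coprime d p
    d⊥p (e∣d , e∣p) = ∤⇒coprime p∤u (∣-trans e∣d d∣u , e∣p)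

  coprime-^⇔∤ : ∀ {u} t → Coprime u (p ^ suc t) ⇔ p ∤ u
  coprime-^⇔∤ {u} t = mk⇔ coprime⇒∤ (λ p∤u → ∤⇒coprime-^ p∤u (suc t))
    where
    coprime⇒∤ : Coprime u (p ^ suc t) → p ∤ u
    coprime⇒∤ u⊥pᵗ⁺¹ p∣u = p≢1 (u⊥pᵗ⁺¹ (p∣u , m∣m*n (p ^ t)))

  -- coprimeᵇ u n is definitionally does (coprime? u n).
  coprimeᵇ-^ : ∀ t u → coprimeᵇ u (p ^ suc t) ≡ not (does (p ∣? u))
  coprimeᵇ-^ t u = does-⇔ (coprime-^⇔∤ t) (coprime? u (p ^ suc t)) (¬? (p ∣? u))

  coprimeᵇ-prime : ∀ u → coprimeᵇ u p ≡ not (does (p ∣? u))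
  coprimeᵇ-prime u = trans (cong (coprimeᵇ u) (sym (ℕ.*-identityʳ p))) (coprimeᵇ-^ 0 u)

  ∤⇒coprimeᵇ : ∀ {u} → p ∤ u → coprimeᵇ u p ≡ true
  ∤⇒coprimeᵇ {u} p∤u = trans (coprimeᵇ-prime u) (cong not (dec-false (p ∣? u) p∤u))

  ∣⇒¬coprimeᵇ : ∀ {u} → p ∣ u → coprimeᵇ u p ≡ false
  ∣⇒¬coprimeᵇ {u} p∣u = trans (coprimeᵇ-prime u) (cong not (dec-true (p ∣? u) p∣u))

  ∣-+-multiple-^ : ∀ {c} t k → p ∣ k ℕ.* p ^ suc t ℕ.+ c → p ∣ c
  ∣-+-multiple-^ t k p∣u = ∣m+n∣m⇒∣n p∣u (∣-trans (m∣m*n (p ^ t)) (n∣m*n k))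

  ∣^⇒∣ : ∀ {c} n → p ∣ c ^ n → p ∣ c
  ∣^⇒∣     zero    p∣1    = contradiction (∣1⇒≡1 p∣1) p≢1
  ∣^⇒∣ {c} (suc n) p∣cⁿ⁺¹ with euclidsLemma c (c ^ n) p-prime p∣cⁿ⁺¹
  ... | inj₁ p∣c  = p∣c
  ... | inj₂ p∣cⁿ = ∣^⇒∣ n p∣cⁿ

  ∤p∸1 : p ∤ p ℕ.∸ 1
  ∤p∸1 with ℕ.nonTrivial⇒n>1 p {{prime⇒nonTrivial p-prime}}
  ... | s≤s (s≤s _) = >⇒∤ (ℕ.n<1+n _)

  ∤⇒nonZero : ∀ {c} → p ∤ c → NonZero c
  ∤⇒nonZero {zero}  p∤0 = contradiction (p ∣0) p∤0
  ∤⇒nonZero {suc _} _   = _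

module Totient where
  open ≡ using (refl; sym; trans; cong)
  open ≡.≡-Reasoning
  open Sum ℕ.+-0-commutativeMonoid

  ∑-const : ∀ n x → ∑ n (λ _ → x) ≡ n ℕ.* x
  ∑-const zero    x = refl
  ∑-const (suc n) x = cong (x ℕ.+_) (∑-const n x)

  length-filter-applyUpTo : ∀ (b : ℕ → Bool) g n →
    length (foldr (λ u us → if b u then u ∷ us else us) [] (applyUpTo g n)) ≡ ∑ n (λ i → if b (g i) then 1 else 0)
  length-filter-applyUpTo b g zero    = refl
  length-filter-applyUpTo b g (suc n) with b (g 0)
  ... | true  = cong suc (length-filter-applyUpTo b (g ∘ suc) n)
  ... | false = length-filter-applyUpTo b (g ∘ suc) n

  count-nonmultiples : ∀ m p .{{_ : NonZero p}} →
                       ∑ (m ℕ.* p) (λ u → if does (p ∣? u) then 0 else 1) ≡ m ℕ.* (p ℕ.∸ 1)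
  count-nonmultiples m p = begin
    N                      ≡⟨ ℕ.m+n∸m≡n m N ⟨
    m ℕ.+ N ℕ.∸ m          ≡⟨ cong (ℕ._∸ m) m*p≡m+N ⟨
    m ℕ.* p ℕ.∸ m          ≡⟨ cong (m ℕ.* p ℕ.∸_) (ℕ.*-identityʳ m) ⟨
    m ℕ.* p ℕ.∸ m ℕ.* 1    ≡⟨ ℕ.*-distribˡ-∸ m p 1 ⟨
    m ℕ.* (p ℕ.∸ 1)        ∎
    where
    N = ∑ (m ℕ.* p) (λ u → if does (p ∣? u) then 0 else 1)
    m*p≡m+N : m ℕ.* p ≡ m ℕ.+ N
    m*p≡m+N = begin
      m ℕ.* p                                                 ≡⟨ trans (∑-const (m ℕ.* p) 1) (ℕ.*-identityʳ _) ⟨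
      ∑ (m ℕ.* p) (λ _ → 1)                                   ≡⟨ ∑-partition (m ℕ.* p) (λ u → does (p ∣? u)) (λ _ → 1) ⟩
      ∑ (m ℕ.* p) (λ u → if does (p ∣? u) then 1 else 0) ℕ.+ N ≡⟨ cong (ℕ._+ N) (∑-multiples m p (λ _ → 1)) ⟩
      ∑ m (λ _ → 1) ℕ.+ N                                     ≡⟨ cong (ℕ._+ N) (trans (∑-const m 1) (ℕ.*-identityʳ m)) ⟩
      m ℕ.+ N                                                 ∎

  φ-prime-^ : ∀ {p} → Prime p → ∀ t → φ (p ^ suc t) ≡ p ^ t ℕ.* (p ℕ.∸ 1)
  φ-prime-^ {p} p-prime t = begin
    φ (p ^ suc t)
      ≡⟨ length-filter-applyUpTo (λ u → coprimeᵇ u (p ^ suc t)) (λ u → u) (p ^ suc t) ⟩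
    ∑ (p ℕ.* p ^ t) (λ u → if coprimeᵇ u (p ^ suc t) then 1 else 0)
      ≡⟨ ∑-congᵖ (p ℕ.* p ^ t) (λ u → cong (λ b → if b then 1 else 0) (coprimeᵇ-^ t u)) ⟩
    ∑ (p ℕ.* p ^ t) (λ u → if not (does (p ∣? u)) then 1 else 0)
      ≡⟨ cong (λ n → ∑ n (λ u → if not (does (p ∣? u)) then 1 else 0)) (ℕ.*-comm p (p ^ t)) ⟩
    ∑ (p ^ t ℕ.* p) (λ u → if not (does (p ∣? u)) then 1 else 0)
      ≡⟨ ∑-congᵖ (p ^ t ℕ.* p) (λ u → if-not (does (p ∣? u))) ⟩
    ∑ (p ^ t ℕ.* p) (λ u → if does (p ∣? u) then 0 else 1)
      ≡⟨ count-nonmultiples (p ^ t) p ⟩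
    p ^ t ℕ.* (p ℕ.∸ 1) ∎
    where
    instance
      p≢0 : NonZero p
      p≢0 = prime⇒nonZero p-prime
    open DivisibilityByPrime p-prime using (coprimeᵇ-^)
    if-not : ∀ b → (if not b then 1 else 0) ≡ (if b then 0 else 1)
    if-not true  = refl
    if-not false = refl

module EulerQuotient {p : ℕ} .{{_ : NonZero p}} (p-prime : Prime p) where
  open ≡ using (refl; sym; trans; cong; cong₂)
  open ≡.≡-Reasoning
  open import Data.Nat.Tactic.RingSolver using (solve-∀)
  open DivisibilityByPrime p-prime using (∤⇒coprimeᵇ; ∣-+-multiple-^; ∣^⇒∣; ∤p∸1; ∤⇒nonZero)
  open Totient using (φ-prime-^)
  open IntegerDivision using (digit-shift)
  open import Data.Integer using (+_; _-_)
  open import Data.Integer.DivMod using (_/ℕ_; _%ℕ_)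

  -- φ(pᵗ) · c^(φ(pᵗ) - 1) = pᵗ⁻¹ · slope t c
  slope : ℕ → ℕ → ℕ
  slope t c = (p ℕ.∸ 1) ℕ.* c ^ pred (φ (p ^ t))

  slope-coprime : ∀ t {c} → p ∤ c → p ∤ slope t c
  slope-coprime t {c} p∤c p∣slope with euclidsLemma (p ℕ.∸ 1) (c ^ pred (φ (p ^ t))) p-prime p∣slope
  ... | inj₁ p∣p∸1 = ∤p∸1 p∣p∸1
  ... | inj₂ p∣cⁿ  = p∤c (∣^⇒∣ (pred (φ (p ^ t))) p∣cⁿ)

  -- The exponent is a module parameter because instance search cannot solve NonZero (p ^ ?t).
  module _ (t : ℕ) where
    private instance
      pᵗ≢0 : NonZero (p ^ t)
      pᵗ≢0 = ℕ.m^n≢0 p t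

    euler-quotient : ℕ → ℕ
    euler-quotient u = (u ^ φ (p ^ t) ℕ.∸ 1) / p ^ t

    Q-coprime : ∀ {u} → p ∤ u → Q p t u ≡ euler-quotient u % p ^ t
    Q-coprime {u} p∤u = cong (λ b → if b then euler-quotient u % p ^ t else 0) (∤⇒coprimeᵇ p∤u)

  module _ (t : ℕ) where
    private instance
      pᵗ⁺¹≢0 : NonZero (p ^ suc t)
      pᵗ⁺¹≢0 = ℕ.m^n≢0 p (suc t)

    Q-shift : ∀ {c} k → p ∤ c →
              Q p (suc t) (k ℕ.* p ^ suc t ℕ.+ c) ≡
              (euler-quotient (suc t) c ℕ.+ p ^ t ℕ.* (slope (suc t) c ℕ.* k)) % p ^ suc t
    Q-shift {c} k p∤c = begin
      Q p (suc t) u                               ≡⟨ Q-coprime (suc t) (p∤c ∘ ∣-+-multiple-^ t k) ⟩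
      ((u ^ N ℕ.∸ 1) / P) % P                     ≡⟨ cong (λ x → ((x ℕ.∸ 1) / P) % P) uᴺ≡ ⟩
      ((c ^ N ℕ.+ Z ℕ.* P ℕ.∸ 1) / P) % P         ≡⟨ cong (λ x → (x / P) % P) (ℕ.+-∸-comm (Z ℕ.* P) 1≤cᴺ) ⟩
      ((c ^ N ℕ.∸ 1 ℕ.+ Z ℕ.* P) / P) % P         ≡⟨ cong (_% P) ([m+kn]/n≡m/n+k (c ^ N ℕ.∸ 1) Z P) ⟩
      (E ℕ.+ Z) % P                               ≡⟨ cong (_% P) (ℕ.+-assoc E _ _) ⟨
      (E ℕ.+ p ^ t ℕ.* m ℕ.+ k ℕ.* k ℕ.* R ℕ.* P) % P ≡⟨ ℕ.[m+kn]%n≡m%n _ (k ℕ.* k ℕ.* R) P ⟩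
      (E ℕ.+ p ^ t ℕ.* m) % P                     ∎
      where
      P = p ^ suc t
      N = φ P
      u = k ℕ.* P ℕ.+ c
      E = euler-quotient (suc t) c
      m = slope (suc t) c ℕ.* k
      R = proj₁ (binomial-mod-d² c (k ℕ.* P) N)
      Z = p ^ t ℕ.* m ℕ.+ k ℕ.* k ℕ.* R ℕ.* P
      1≤cᴺ : 1 ≤ c ^ N
      1≤cᴺ = ℕ.m^n>0 c {{∤⇒nonZero p∤c}} N
      regroup : ∀ X a q C k P R → X ℕ.+ a ℕ.* q ℕ.* C ℕ.* (k ℕ.* P) ℕ.+ k ℕ.* P ℕ.* (k ℕ.* P) ℕ.* R ≡
                X ℕ.+ (a ℕ.* (q ℕ.* C ℕ.* k) ℕ.+ k ℕ.* k ℕ.* R ℕ.* P) ℕ.* P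
      regroup = solve-∀
      uᴺ≡ : u ^ N ≡ c ^ N ℕ.+ Z ℕ.* P
      uᴺ≡ = begin
        (k ℕ.* P ℕ.+ c) ^ N
          ≡⟨ cong (_^ N) (ℕ.+-comm (k ℕ.* P) c) ⟩
        (c ℕ.+ k ℕ.* P) ^ N
          ≡⟨ proj₂ (binomial-mod-d² c (k ℕ.* P) N) ⟩
        c ^ N ℕ.+ N ℕ.* c ^ pred N ℕ.* (k ℕ.* P) ℕ.+ k ℕ.* P ℕ.* (k ℕ.* P) ℕ.* R
          ≡⟨ cong (λ n → c ^ N ℕ.+ n ℕ.* c ^ pred N ℕ.* (k ℕ.* P) ℕ.+ k ℕ.* P ℕ.* (k ℕ.* P) ℕ.* R) (φ-prime-^ p-prime t) ⟩
        c ^ N ℕ.+ p ^ t ℕ.* (p ℕ.∸ 1) ℕ.* c ^ pred N ℕ.* (k ℕ.* P) ℕ.+ k ℕ.* P ℕ.* (k ℕ.* P) ℕ.* R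
          ≡⟨ regroup (c ^ N) (p ^ t) (p ℕ.∸ 1) (c ^ pred N) k P R ⟩
        c ^ N ℕ.+ Z ℕ.* P ∎

    Q-invariant : ∀ {c} k → p ∤ c → Q p (suc t) (k ℕ.* p ^ suc (suc t) ℕ.+ c) ≡ Q p (suc t) c
    Q-invariant {c} k p∤c = begin
      Q p (suc t) (k ℕ.* (p ℕ.* P) ℕ.+ c)        ≡⟨ cong (λ x → Q p (suc t) (x ℕ.+ c)) (ℕ.*-assoc k p P) ⟨
      Q p (suc t) (k ℕ.* p ℕ.* P ℕ.+ c)          ≡⟨ Q-shift (k ℕ.* p) p∤c ⟩
      (E ℕ.+ p ^ t ℕ.* (s ℕ.* (k ℕ.* p))) % P   ≡⟨ cong (λ x → (E ℕ.+ x) % P) (regroup (p ^ t) s k p) ⟩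
      (E ℕ.+ s ℕ.* k ℕ.* P) % P                 ≡⟨ ℕ.[m+kn]%n≡m%n E (s ℕ.* k) P ⟩
      E % P                                     ≡⟨ Q-coprime (suc t) p∤c ⟨
      Q p (suc t) c                             ∎
      where
      P = p ^ suc t
      E = euler-quotient (suc t) c
      s = slope (suc t) c
      regroup : ∀ a s k p → a ℕ.* (s ℕ.* (k ℕ.* p)) ≡ s ℕ.* k ℕ.* (p ℕ.* a)
      regroup = solve-∀

  H-shift : ∀ s {c} k → p ∤ c →
            H p (suc (suc s)) (k ℕ.* p ^ suc (suc s) ℕ.+ c) ≡ (H p (suc (suc s)) c ℕ.+ slope (suc (suc s)) c ℕ.* k) % p
  H-shift s {c} k p∤c = begin
    ((+ Q p r u - + Q p (suc s) u) /ℕ P) %ℕ p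
      ≡⟨ cong₂ (λ a b → ((+ a - + b) /ℕ P) %ℕ p) (Q-shift (suc s) k p∤c) (Q-invariant s k p∤c) ⟩
    ((+ ((E ℕ.+ P ℕ.* m) % (p ℕ.* P)) - + w) /ℕ P) %ℕ p
      ≡⟨ digit-shift p P E m w ⟩
    ((((+ (E % (p ℕ.* P)) - + w) /ℕ P) %ℕ p) ℕ.+ m) % p
      ≡⟨ cong (λ a → ((((+ a - + w) /ℕ P) %ℕ p) ℕ.+ m) % p) (Q-coprime r p∤c) ⟨
    (H p r c ℕ.+ m) % p ∎
    where
    instance
      pˢ⁺¹≢0 : NonZero (p ^ suc s)
      pˢ⁺¹≢0 = ℕ.m^n≢0 p (suc s)
      pˢ⁺²≢0 : NonZero (p ^ suc (suc s))
      pˢ⁺²≢0 = ℕ.m^n≢0 p (suc (suc s))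
    r = suc (suc s)
    P = p ^ suc s
    u = k ℕ.* p ^ r ℕ.+ c
    E = euler-quotient r c
    m = slope r c ℕ.* k
    w = Q p (suc s) c

module AffineModPrime {p} .{{_ : NonZero p}} (p-prime : Prime p) {a} (p∤a : p ∤ a) (h : ℕ) where
  open ≡ using (sym; trans; cong)

  affine : ℕ → ℕ
  affine j = (h ℕ.+ a ℕ.* j) % p

  affine-injective-≤ : ∀ {j j′} → j ≤ j′ → j′ < p → affine j ≡ affine j′ → j ≡ j′
  affine-injective-≤ {j} {j′} j≤j′ j′<p eq with euclidsLemma a δ p-prime p∣aδ
    where
    δ = j′ ℕ.∸ j
    j′≡j+δ : h ℕ.+ a ℕ.* j′ ≡ h ℕ.+ a ℕ.* j ℕ.+ a ℕ.* δ
    j′≡j+δ = begin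
      h ℕ.+ a ℕ.* j′                 ≡⟨ cong (λ x → h ℕ.+ a ℕ.* x) (ℕ.m+[n∸m]≡n j≤j′) ⟨
      h ℕ.+ a ℕ.* (j ℕ.+ δ)          ≡⟨ cong (h ℕ.+_) (ℕ.*-distribˡ-+ a j δ) ⟩
      h ℕ.+ (a ℕ.* j ℕ.+ a ℕ.* δ)    ≡⟨ ℕ.+-assoc h (a ℕ.* j) (a ℕ.* δ) ⟨
      h ℕ.+ a ℕ.* j ℕ.+ a ℕ.* δ      ∎
      where open ≡.≡-Reasoning
    p∣aδ : p ∣ a ℕ.* δ
    p∣aδ = [m+n]%d≡m%d⇒d∣n (h ℕ.+ a ℕ.* j) (a ℕ.* δ) p (trans (cong (_% p) (sym j′≡j+δ)) (sym eq))
  ... | inj₁ p∣a = contradiction p∣a p∤a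
  ... | inj₂ p∣δ with j′ ℕ.∸ j in δ≡ | ℕ.≤-<-trans (ℕ.m∸n≤m j′ j) j′<p
  ...   | zero  | _   = ℕ.≤-antisym j≤j′ (ℕ.m∸n≡0⇒m≤n δ≡)
  ...   | suc _ | δ<p = contradiction p∣δ (>⇒∤ δ<p)

  affine-injective : ∀ {j j′} → j < p → j′ < p → affine j ≡ affine j′ → j ≡ j′
  affine-injective {j} {j′} j<p j′<p eq with ℕ.≤-total j j′
  ... | inj₁ j≤j′ = affine-injective-≤ j≤j′ j′<p eq
  ... | inj₂ j′≤j = sym (affine-injective-≤ j′≤j j<p (sym eq))

  affine-surjective : ∀ {l} → l < p → ∃ λ j → j < p × affine j ≡ l
  affine-surjective {l} l<p =
    let j , affineᶠj≡l = injective⇒surjective affineᶠ-injective (fromℕ< l<p) in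
    toℕ j , toℕ<n j , (begin
      affine (toℕ j)          ≡⟨ toℕ-fromℕ< _ ⟨
      toℕ (affineᶠ j)         ≡⟨ cong toℕ affineᶠj≡l ⟩
      toℕ (fromℕ< l<p)        ≡⟨ toℕ-fromℕ< l<p ⟩
      l                       ∎)
    where
    open ≡.≡-Reasoning
    affineᶠ : Fin p → Fin p
    affineᶠ j = fromℕ< (ℕ.m%n<n (h ℕ.+ a ℕ.* toℕ j) p)
    affineᶠ-injective : Injective _≡_ _≡_ affineᶠ
    affineᶠ-injective {j} {j′} eq = toℕ-injective (affine-injective (toℕ<n j) (toℕ<n j′)
      (trans (sym (toℕ-fromℕ< _)) (trans (cong toℕ eq) (toℕ-fromℕ< _))))

module RingSums {c ℓ} (R : CommutativeRing c ℓ) where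
  open CommutativeRing R
  open Sum +-commutativeMonoid
  open import Relation.Binary.Reasoning.Setoid setoid
  import Algebra.Properties.Semiring.Exp semiring as Exp
  open import Algebra.Properties.Group +-group using (∙-cancelʳ)
  open import Algebra.Properties.Ring ring using (-1*x≈-x)
  open import Data.Maybe using (nothing)
  open import Tactic.RingSolver.Core.AlmostCommutativeRing using (fromCommutativeRing)
  open import Tactic.RingSolver.NonReflective (fromCommutativeRing R (λ _ → nothing)) using (solve; _⊜_; _⊕_; _⊗_)

  pow≡^ : ∀ x n → pow R x n ≡ x Exp.^ n
  pow≡^ x zero    = ≡.refl
  pow≡^ x (suc n) = ≡.cong (x *_) (pow≡^ x n)

  pow-homo-+ : ∀ x m n → pow R x (m ℕ.+ n) ≈ pow R x m * pow R x n
  pow-homo-+ x m n rewrite pow≡^ x (m ℕ.+ n) | pow≡^ x m | pow≡^ x n = Exp.^-homo-* x m n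

  pow-assocʳ : ∀ x m n → pow R (pow R x m) n ≈ pow R x (m ℕ.* n)
  pow-assocʳ x m n rewrite pow≡^ x m | pow≡^ (x Exp.^ m) n | pow≡^ x (m ℕ.* n) = Exp.^-assocʳ x m n

  pow-congˡ : ∀ n {x y} → x ≈ y → pow R x n ≈ pow R y n
  pow-congˡ n {x} {y} x≈y rewrite pow≡^ x n | pow≡^ y n = Exp.^-congˡ n x≈y

  1ⁿ≈1 : ∀ n → pow R 1# n ≈ 1#
  1ⁿ≈1 zero    = refl
  1ⁿ≈1 (suc n) = trans (*-identityˡ _) (1ⁿ≈1 n)

  ∑-*ˡ : ∀ n x f → ∑ n (λ i → x * f i) ≈ x * ∑ n f
  ∑-*ˡ zero    x f = sym (zeroʳ x)
  ∑-*ˡ (suc n) x f = trans (+-cong refl (∑-*ˡ n x (f ∘ suc))) (sym (distribˡ x _ _))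

  geometric-telescope : ∀ x n → x * ∑ n (pow R x) + 1# ≈ ∑ n (pow R x) + pow R x n
  geometric-telescope x zero    = +-cong (zeroʳ x) refl
  geometric-telescope x (suc n) = begin
    x * (1# + ∑ n (λ i → x * pow R x i)) + 1#  ≈⟨ +-cong (*-cong refl (+-cong refl (∑-*ˡ n x (pow R x)))) refl ⟩
    x * (1# + x * S) + 1#                      ≈⟨ +-cong (*-cong refl (+-comm 1# (x * S))) refl ⟩
    x * (x * S + 1#) + 1#                      ≈⟨ +-cong (*-cong refl (geometric-telescope x n)) refl ⟩
    x * (S + pow R x n) + 1#                   ≈⟨ regroup x S (pow R x n) 1# ⟩
    (1# + x * S) + x * pow R x n               ≈⟨ +-cong (+-cong refl (∑-*ˡ n x (pow R x))) refl ⟨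
    (1# + ∑ n (λ i → x * pow R x i)) + x * pow R x n ∎
    where
    S = ∑ n (pow R x)
    regroup : ∀ x S X o → x * (S + X) + o ≈ (o + x * S) + x * X
    regroup = solve 4 (λ x S X o → (x ⊗ (S ⊕ X) ⊕ o) ⊜ ((o ⊕ x ⊗ S) ⊕ x ⊗ X)) refl

  geometric-sum≈0 : ∀ {x y} n → (x - 1#) * y ≈ 1# → pow R x n ≈ 1# → ∑ n (pow R x) ≈ 0#
  geometric-sum≈0 {x} {y} n [x-1]y≈1 xⁿ≈1 = begin
    S                  ≈⟨ *-identityˡ S ⟨
    1# * S             ≈⟨ *-cong [x-1]y≈1 refl ⟨
    ((x - 1#) * y) * S ≈⟨ trans (*-cong (*-comm _ y) refl) (*-assoc y _ S) ⟩
    y * ((x - 1#) * S) ≈⟨ *-cong refl [x-1]S≈0 ⟩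
    y * 0#             ≈⟨ zeroʳ y ⟩
    0#                 ∎
    where
    S = ∑ n (pow R x)
    xS≈S : x * S ≈ S
    xS≈S = ∙-cancelʳ 1# (x * S) S (trans (geometric-telescope x n) (+-cong refl xⁿ≈1))
    [x-1]S≈0 : (x - 1#) * S ≈ 0#
    [x-1]S≈0 = begin
      (x - 1#) * S       ≈⟨ distribʳ S x (- 1#) ⟩
      x * S + - 1# * S   ≈⟨ +-cong xS≈S (-1*x≈-x S) ⟩
      S - S              ≈⟨ -‿inverseʳ S ⟩
      0#                 ∎

  pow-periodic : ∀ {x} P → pow R x P ≈ 1# → ∀ j c → pow R x (j ℕ.* P ℕ.+ c) ≈ pow R x c
  pow-periodic {x} P xᴾ≈1 j c = begin
    pow R x (j ℕ.* P ℕ.+ c)              ≈⟨ pow-homo-+ x (j ℕ.* P) c ⟩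
    pow R x (j ℕ.* P) * pow R x c        ≈⟨ *-cong (reflexive (≡.cong (pow R x) (ℕ.*-comm j P))) refl ⟩
    pow R x (P ℕ.* j) * pow R x c        ≈⟨ *-cong (pow-assocʳ x P j) refl ⟨
    pow R (pow R x P) j * pow R x c      ≈⟨ *-cong (trans (pow-congˡ j xᴾ≈1) (1ⁿ≈1 j)) refl ⟩
    1# * pow R x c                       ≈⟨ *-identityˡ _ ⟩
    pow R x c                            ∎

  x≉1⇒x-1-invertible : (∀ a → ¬ (a ≈ 0#) → ∃ λ b → a * b ≈ 1#) → ∀ {x} → ¬ (x ≈ 1#) → ∃ λ y → (x - 1#) * y ≈ 1#
  x≉1⇒x-1-invertible inverse {x} x≉1 = inverse (x - 1#) (λ x-1≈0 → x≉1 (begin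
    x                ≈⟨ +-identityʳ x ⟨
    x + 0#           ≈⟨ +-cong refl (-‿inverseˡ 1#) ⟨
    x + (- 1# + 1#)  ≈⟨ +-assoc x (- 1#) 1# ⟨
    (x - 1#) + 1#    ≈⟨ +-cong x-1≈0 refl ⟩
    0# + 1#          ≈⟨ +-identityˡ 1# ⟩
    1#               ∎))

  ∑-nonmultiples≈0 : (∀ a → ¬ (a ≈ 0#) → ∃ λ b → a * b ≈ 1#) → ∀ p m .{{_ : NonZero p}} {θ} →
                     pow R θ (p ℕ.* m) ≈ 1# → ¬ (pow R θ p ≈ 1#) →
                     ∑ (p ℕ.* m) (λ u → if does (p ∣? u) then 0# else pow R θ u) ≈ 0#
  ∑-nonmultiples≈0 inverse p m {θ} θᵖᵐ≈1 θᵖ≉1 = begin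
    N                      ≈⟨ +-identityˡ N ⟨
    0# + N                 ≈⟨ +-cong M≈0 refl ⟨
    M + N                  ≈⟨ ∑-partition (p ℕ.* m) (λ u → does (p ∣? u)) (pow R θ) ⟨
    ∑ (p ℕ.* m) (pow R θ)  ≈⟨ geometric-sum≈0 (p ℕ.* m) (proj₂ (x≉1⇒x-1-invertible inverse θ≉1)) θᵖᵐ≈1 ⟩
    0#                     ∎
    where
    on-multiples : ℕ → Carrier
    on-multiples u = if does (p ∣? u) then pow R θ u else 0#
    M = ∑ (p ℕ.* m) on-multiples
    N = ∑ (p ℕ.* m) (λ u → if does (p ∣? u) then 0# else pow R θ u)
    θ≉1 : ¬ (θ ≈ 1#)
    θ≉1 θ≈1 = θᵖ≉1 (trans (pow-congˡ p θ≈1) (1ⁿ≈1 p))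
    M≈0 : M ≈ 0#
    M≈0 = begin
      M                                   ≈⟨ reflexive (≡.cong (λ n → ∑ n on-multiples) (ℕ.*-comm p m)) ⟩
      ∑ (m ℕ.* p) on-multiples            ≈⟨ ∑-multiples m p (pow R θ) ⟩
      ∑ m (λ j → pow R θ (j ℕ.* p))       ≈⟨ ∑-cong m (λ j _ → trans (reflexive (≡.cong (pow R θ) (ℕ.*-comm j p))) (sym (pow-assocʳ θ p j))) ⟩
      ∑ m (pow R (pow R θ p))             ≈⟨ geometric-sum≈0 m (proj₂ (x≉1⇒x-1-invertible inverse θᵖ≉1)) (trans (pow-assocʳ θ p m) θᵖᵐ≈1) ⟩
      0#                                  ∎

  evalSum-applyUpTo : ∀ (b : ℕ → Bool) θ g n →
    foldr (λ u acc → if b u then pow R θ u + acc else acc) 0# (applyUpTo g n) ≈ ∑ n (λ i → if b (g i) then pow R θ (g i) else 0#)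
  evalSum-applyUpTo b θ g zero    = refl
  evalSum-applyUpTo b θ g (suc n) with b (g 0)
  ... | true  = +-cong refl (evalSum-applyUpTo b θ (g ∘ suc) n)
  ... | false = trans (evalSum-applyUpTo b θ (g ∘ suc) n) (sym (+-identityˡ _))

  evalSum≈∑ : ∀ (b : ℕ → Bool) N θ → evalSum R b N θ ≈ ∑ N (λ u → if b u then pow R θ u else 0#)
  evalSum≈∑ b N θ = evalSum-applyUpTo b θ (λ u → u) N

module Fibres {p} .{{_ : NonZero p}} (p-prime : Prime p) (s : ℕ) {l} (l<p : l < p) where
  open DivisibilityByPrime p-prime using (∤⇒coprimeᵇ; ∣⇒¬coprimeᵇ; ∣-+-multiple-^)
  open EulerQuotient p-prime using (slope-coprime; H-shift)

  private
    r = suc (suc s)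
    P = p ^ r

  fibre-∣ : ∀ {c} → p ∣ c → ∀ j → inDᵇ p r l (j ℕ.* P ℕ.+ c) ≡ false
  fibre-∣ {c} p∣c j = ≡.cong (_∧ (H p r (j ℕ.* P ℕ.+ c) ℕ.≡ᵇ l))
    (∣⇒¬coprimeᵇ (∣m∣n⇒∣m+n (∣-trans (m∣m*n (p ^ suc s)) (n∣m*n j)) p∣c))

  fibre-∤ : ∀ {c} → p ∤ c → ∃ λ j₀ → j₀ < p × inDᵇ p r l (j₀ ℕ.* P ℕ.+ c) ≡ true ×
            (∀ j → j < p → j ≢ j₀ → inDᵇ p r l (j ℕ.* P ℕ.+ c) ≡ false)
  fibre-∤ {c} p∤c =
    let j₀ , j₀<p , affine-j₀≡l = affine-surjective l<p in
    j₀ , j₀<p , ≡.trans (inD≡ j₀) (dec-true (affine j₀ ℕ.≟ l) affine-j₀≡l) ,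
    λ j j<p j≢j₀ → ≡.trans (inD≡ j) (dec-false (affine j ℕ.≟ l)
      (λ affine-j≡l → j≢j₀ (affine-injective j<p j₀<p (≡.trans affine-j≡l (≡.sym affine-j₀≡l)))))
    where
    open AffineModPrime p-prime (slope-coprime r p∤c) (H p r c)
    inD≡ : ∀ j → inDᵇ p r l (j ℕ.* P ℕ.+ c) ≡ does (affine j ℕ.≟ l)
    inD≡ j = ≡.cong₂ _∧_ (∤⇒coprimeᵇ (p∤c ∘ ∣-+-multiple-^ (suc s) j)) (≡.cong (ℕ._≡ᵇ l) (H-shift s j p∤c))

  module Powers {c ℓ} (F : CommutativeRing c ℓ) where
    open CommutativeRing F
    open Sum +-commutativeMonoid
    open RingSums F using (pow-periodic)

    D-summand : Carrier → ℕ → Carrier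
    D-summand θ u = if inDᵇ p r l u then pow F θ u else 0#

    fibre-sum-∣ : ∀ θ {c} → p ∣ c → ∑ p (λ j → D-summand θ (j ℕ.* P ℕ.+ c)) ≈ 0#
    fibre-sum-∣ θ {c} p∣c = ∑-ε p (λ j _ →
      reflexive (≡.cong (λ b → if b then pow F θ (j ℕ.* P ℕ.+ c) else 0#) (fibre-∣ p∣c j)))

    fibre-sum-∤ : ∀ {θ} → pow F θ P ≈ 1# → ∀ {c} → p ∤ c → ∑ p (λ j → D-summand θ (j ℕ.* P ℕ.+ c)) ≈ pow F θ c
    fibre-sum-∤ {θ} θᴾ≈1 {c} p∤c =
      let j₀ , j₀<p , in-fibre , others = fibre-∤ p∤c in
      ∑-single p j₀ j₀<p
        (trans (reflexive (≡.cong (λ b → if b then pow F θ (j₀ ℕ.* P ℕ.+ c) else 0#) in-fibre)) (pow-periodic P θᴾ≈1 j₀ c))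
        (λ j j<p j≢j₀ → reflexive (≡.cong (λ b → if b then pow F θ (j ℕ.* P ℕ.+ c) else 0#) (others j j<p j≢j₀)))

    fibre-sum : ∀ {θ} → pow F θ P ≈ 1# → ∀ c →
                ∑ p (λ j → D-summand θ (j ℕ.* P ℕ.+ c)) ≈ (if does (p ∣? c) then 0# else pow F θ c)
    fibre-sum {θ} θᴾ≈1 c = by-cases (p ∣? c) (fibre-sum-∣ θ) (fibre-sum-∤ θᴾ≈1)
      where
      by-cases : ∀ {A : Set} (a? : Dec A) {x y z} → (A → x ≈ y) → (¬ A → x ≈ z) → x ≈ (if does a? then y else z)
      by-cases (yes a) x≈y _   = x≈y a
      by-cases (no ¬a) _   x≈z = x≈z ¬a

lemma2 : {c ℓ : Level} (F : CommutativeRing c ℓ) → IsFieldChar2 F →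
         (p : ℕ) .{{_ : NonZero p}} → Prime p → ¬ (p ≡ 2) → (r : ℕ) → 2 ≤ r →
         (θ : CommutativeRing.Carrier F) →
         CommutativeRing._≈_ F (pow F θ (p ^ r)) (CommutativeRing.1# F) →
         ¬ (CommutativeRing._≈_ F (pow F θ p) (CommutativeRing.1# F)) →
         (l : ℕ) → l < p →
         CommutativeRing._≈_ F (Deval F p r l θ) (CommutativeRing.0# F)
lemma2 F F-field p p-prime _ r@(suc (suc s)) (s≤s (s≤s z≤n)) θ θᴾ≈1 θᵖ≉1 l l<p = begin
  Deval F p r l θ                                      ≈⟨ evalSum≈∑ (inDᵇ p r l) (p ^ suc r) θ ⟩
  ∑ (p ℕ.* P) (D-summand θ)                            ≈⟨ ∑-blocks p P (D-summand θ) ⟩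
  ∑ p (λ j → ∑ P (λ c → D-summand θ (j ℕ.* P ℕ.+ c)))  ≈⟨ ∑-comm P p (λ j c → D-summand θ (j ℕ.* P ℕ.+ c)) ⟩
  ∑ P (λ c → ∑ p (λ j → D-summand θ (j ℕ.* P ℕ.+ c)))  ≈⟨ ∑-cong P (λ c _ → fibre-sum θᴾ≈1 c) ⟩
  ∑ P (λ c → if does (p ∣? c) then 0# else pow F θ c)
    ≈⟨ ∑-nonmultiples≈0 (IsFieldChar2.inverse F-field) p (p ^ suc s) θᴾ≈1 θᵖ≉1 ⟩
  0#                                                   ∎
  where
  open CommutativeRing F
  open Sum +-commutativeMonoid
  open RingSums F using (evalSum≈∑; ∑-nonmultiples≈0)
  open Fibres.Powers p-prime s l<p F using (D-summand; fibre-sum)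
  open import Relation.Binary.Reasoning.Setoid setoid
  P = p ^ r
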